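{- Let $0\leq p\leq n$ and let $f_{n,p}$ be the number of maximal hypercubes of dimension $p$ in the Fibonacci cube $\Gamma_n$. Then \[f_{n,p}=\binom{p+1}{n-2p+1}.\]
   Context: $Q_n$ is the $n$-dimensional hypercube: vertices are binary strings of length $n$, adjacent iff they differ in exactly one coordinate. A Fibonacci string of length $n$ is a binary string $b_1\dots b_n$ with $b_ib_{i+1}=0$ for $1\le i<n$; the Fibonacci cube $\Gamma_n$ ($n\ge1$) is the subgraph of $Q_n$ induced by the Fibonacci strings of length $n$, and $\Gamma_0=K_1$. A hypercube of dimension $p$ in $\Gamma_n$ is an induced subgraph isomorphic to $Q_p$; it is maximal if it is not contained in any induced subgraph of $\Gamma_n$ isomorphic to $Q_{p+1}$. Binomial coefficients $\binom{a}{b}$ are $0$ when $b<0$ or $b>a$. -}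

module Defs where

open import Data.Nat using (ℕ; zero; suc; _+_; _*_; _∸_; _<ᵇ_)
open import Data.Nat.Combinatorics using (_C_)
open import Data.Bool using (Bool; true; false; if_then_else_)
open import Data.Vec using (Vec; []; _∷_)
open import Data.Product using (Σ; _×_; ∃)
open import Data.Empty using (⊥)
open import Relation.Nullary using (¬_)
open import Relation.Binary.PropositionalEquality using (_≡_)
open import Function.Bundles using (_⇔_)

Word : ℕ → Set
Word n = Vec Bool n

hamming : ∀ {n} → Word n → Word n → ℕ
hamming [] [] = 0
hamming (a ∷ xs) (b ∷ ys) = (if a Data.Bool.xor b then 1 else 0) + hamming xs ys
  where import Data.Bool

Adj : ∀ {n} → Word n → Word n → Set
Adj x y = hamming x y ≡ 1

Fib : ∀ {n} → Word n → Set
Fib [] = Data.Unit.⊤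
  where import Data.Unit
Fib (a ∷ []) = Data.Unit.⊤
  where import Data.Unit
Fib (true ∷ true ∷ xs) = ⊥
Fib (true ∷ false ∷ xs) = Fib (false ∷ xs)
Fib (false ∷ xs) = Fib xs

-- Vertex subsets of Q_n, as a canonical decision tree on the bits
-- (so that two subsets are equal iff they are ≡).
Sub : ℕ → Set
Sub zero = Bool
Sub (suc n) = Sub n × Sub n   -- (part with first bit 0, part with first bit 1)

mem : ∀ {n} → Sub n → Word n → Bool
mem {zero} b [] = b
mem {suc n} (s₀ Data.Product., s₁) (false ∷ xs) = mem s₀ xs
mem {suc n} (s₀ Data.Product., s₁) (true ∷ xs) = mem s₁ xs

_∈ˢ_ : ∀ {n} → Word n → Sub n → Set
v ∈ˢ S = mem S v ≡ true

_⊆ˢ_ : ∀ {n} → Sub n → Sub n → Set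
S ⊆ˢ T = ∀ v → v ∈ˢ S → v ∈ˢ T

-- S is (the vertex set of) a hypercube of dimension p in Γ_n:
-- S consists of Fibonacci strings and the subgraph induced by S
-- (in Q_n, equivalently in Γ_n) is isomorphic to Q_p via φ.
IsHypercube : (n p : ℕ) → Sub n → Set
IsHypercube n p S =
  Σ (Word p → Word n) λ φ →
    (∀ x → Fib (φ x)) ×
    (∀ x → φ x ∈ˢ S) ×
    (∀ v → v ∈ˢ S → ∃ λ x → φ x ≡ v) ×
    (∀ x y → φ x ≡ φ y → x ≡ y) ×
    (∀ x y → Adj x y ⇔ Adj (φ x) (φ y))

IsMaximalHypercube : (n p : ℕ) → Sub n → Set
IsMaximalHypercube n p S =
  IsHypercube n p S × ¬ (Σ (Sub n) λ T → IsHypercube n (suc p) T × S ⊆ˢ T)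

-- binom(p+1, n-2p+1) with the convention that it is 0 when n-2p+1 < 0.
fibMaxCount : ℕ → ℕ → ℕ
fibMaxCount n p = if (n + 1) <ᵇ (2 * p) then 0 else (suc p) C ((n + 1) ∸ (2 * p))

-- A hypercube of Q_n is a subcube: a word over {0, 1, ∗} whose vertices are its
-- fillings of the ∗ positions.  Induct on the dimension, splitting Q_{p+1} into two
-- copies of Q_p: their images are disjoint subcubes matched by edges, and two
-- such subcubes differ in exactly one fixed coordinate.  The subcube lies in Γ_n
-- iff no two consecutive symbols lie in {1, ∗}, and it is contained in another
-- one iff the latter arises by turning fixed symbols into ∗.  So the maximal
-- hypercubes of Γ_n are the words over {0, ∗} with no two consecutive ∗ in which
-- every 0 is next to a ∗.  Sorting these by whether they start with ∗ or with 0∗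
-- gives Pascal's recurrence for binom(p + 1, n - 2p + 1).
module Submission where

open import Defs
open import Data.Nat using (ℕ; zero; suc; _+_; _*_; _∸_; _<ᵇ_; _≤_)
open import Data.Nat.Properties using (suc-injective; +-comm; *-suc; 1+n≢n)
open import Data.Nat.Combinatorics using (_C_; nCk+nC[k+1]≡[n+1]C[k+1])
open import Data.Bool using (Bool; true; false; not; _≟_; if_then_else_)
open import Data.Bool.Properties using (not-¬; ¬-not; ⇔→≡)
open import Data.Vec using (Vec; []; _∷_; replicate)
import Data.Vec as Vec
open import Data.Vec.Properties using (∷-injectiveˡ; ∷-injectiveʳ)
open import Data.Vec.Relation.Binary.Pointwise.Inductive as Pointwise
  using (Pointwise; []; _∷_)
open import Data.List using (List; length; map; _++_) renaming ([] to []ᴸ; [_] to [_]ᴸ)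
open import Data.List.Properties using (length-map; length-++)
open import Data.List.Relation.Unary.Unique.Propositional using (Unique)
import Data.List.Relation.Unary.Unique.Propositional.Properties as Unique
open import Data.List.Membership.Propositional using (_∈_)
open import Data.List.Membership.Propositional.Properties
  using (∈-map⁺; ∈-map⁻; ∈-++⁺ˡ; ∈-++⁺ʳ; ∈-++⁻)
open import Data.List.Relation.Unary.Any using (here)
open import Data.Product using (Σ; Σ-syntax; ∃; _×_; _,_; proj₂)
open import Data.Sum using (_⊎_; inj₁; inj₂)
import Data.Sum as Sum
import Data.Product as Product
import Data.List.Relation.Unary.All as All
import Data.List.Relation.Unary.AllPairs as AllPairs
open import Data.Empty using (⊥; ⊥-elim)
open import Data.Unit using (tt)
open import Relation.Nullary using (¬_; yes; no)
open import Relation.Binary.PropositionalEquality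
open import Function using (_∘_; id)
open import Function.Bundles using (_⇔_; mk⇔; Equivalence)
open import Function.Definitions using (Injective)

private variable
  n p : ℕ
  b l : Bool

hamming-refl : ∀ (x : Word n) → hamming x x ≡ 0
hamming-refl [] = refl
hamming-refl (false ∷ x) = hamming-refl x
hamming-refl (true ∷ x) = hamming-refl x

hamming≡0⇒≡ : ∀ (x y : Word n) → hamming x y ≡ 0 → x ≡ y
hamming≡0⇒≡ [] [] _ = refl
hamming≡0⇒≡ (false ∷ x) (false ∷ y) h = cong (false ∷_) (hamming≡0⇒≡ x y h)
hamming≡0⇒≡ (true ∷ x) (true ∷ y) h = cong (true ∷_) (hamming≡0⇒≡ x y h)

Adj-flip : ∀ b (x : Word n) → Adj (b ∷ x) (not b ∷ x)
Adj-flip false x = cong suc (hamming-refl x)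
Adj-flip true x = cong suc (hamming-refl x)

Adj-∷-≢ : ∀ b c (x y : Word n) → b ≢ c → Adj (b ∷ x) (c ∷ y) → x ≡ y
Adj-∷-≢ false false _ _ b≢c _ = ⊥-elim (b≢c refl)
Adj-∷-≢ false true x y _ adj = hamming≡0⇒≡ x y (suc-injective adj)
Adj-∷-≢ true false x y _ adj = hamming≡0⇒≡ x y (suc-injective adj)
Adj-∷-≢ true true _ _ b≢c _ = ⊥-elim (b≢c refl)

Adj-∷⁻ : ∀ b (x y : Word n) → Adj (b ∷ x) (b ∷ y) → Adj x y
Adj-∷⁻ false _ _ adj = adj
Adj-∷⁻ true _ _ adj = adj

Fib-false∷⁺ : ∀ (x : Word n) → Fib x → Fib (false ∷ x)
Fib-false∷⁺ [] _ = tt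
Fib-false∷⁺ (_ ∷ _) fib = fib

Fib-false∷⁻ : ∀ (x : Word n) → Fib (false ∷ x) → Fib x
Fib-false∷⁻ [] _ = tt
Fib-false∷⁻ (_ ∷ _) fib = fib

Fib-true∷⇒false∷ : ∀ (x : Word n) → Fib (true ∷ x) → Fib (false ∷ x)
Fib-true∷⇒false∷ [] _ = tt
Fib-true∷⇒false∷ (false ∷ _) fib = fib

Sub-ext : ∀ (S T : Sub n) → (∀ v → v ∈ˢ S ⇔ v ∈ˢ T) → S ≡ T
Sub-ext {zero} S T S⇔T = ⇔→≡ (S⇔T [])
Sub-ext {suc n} (S₀ , S₁) (T₀ , T₁) S⇔T =
  cong₂ _,_ (Sub-ext S₀ T₀ (S⇔T ∘ (false ∷_))) (Sub-ext S₁ T₁ (S⇔T ∘ (true ∷_)))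

data Symbol : Set where
  bit : Bool → Symbol
  ∗ : Symbol

Subcube : ℕ → Set
Subcube = Vec Symbol

private variable
  a a' : Symbol
  w w' w₀ w₁ : Subcube n

dim : Subcube n → ℕ
dim [] = 0
dim (bit _ ∷ w) = dim w
dim (∗ ∷ w) = suc (dim w)

data Matches : Bool → Symbol → Set where
  bit : Matches b (bit b)
  ∗ : Matches b ∗

_∈ᶜ_ : Word n → Subcube n → Set
v ∈ᶜ w = Pointwise Matches v w

_⊆ᶜ_ : Subcube n → Subcube n → Set
w ⊆ᶜ w' = ∀ {v} → v ∈ᶜ w → v ∈ᶜ w'

∅ : Sub n
∅ {zero} = false
∅ {suc n} = ∅ , ∅

∉∅ : ∀ (v : Word n) → ¬ v ∈ˢ ∅
∉∅ [] ()
∉∅ (false ∷ v) = ∉∅ v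
∉∅ (true ∷ v) = ∉∅ v

⟦_⟧ : Subcube n → Sub n
⟦ [] ⟧ = true
⟦ bit false ∷ w ⟧ = ⟦ w ⟧ , ∅
⟦ bit true ∷ w ⟧ = ∅ , ⟦ w ⟧
⟦ ∗ ∷ w ⟧ = ⟦ w ⟧ , ⟦ w ⟧

∈⟦⟧⁺ : ∀ {v : Word n} → v ∈ᶜ w → v ∈ˢ ⟦ w ⟧
∈⟦⟧⁺ [] = refl
∈⟦⟧⁺ (bit {false} ∷ v∈w) = ∈⟦⟧⁺ v∈w
∈⟦⟧⁺ (bit {true} ∷ v∈w) = ∈⟦⟧⁺ v∈w
∈⟦⟧⁺ (∗ {false} ∷ v∈w) = ∈⟦⟧⁺ v∈w
∈⟦⟧⁺ (∗ {true} ∷ v∈w) = ∈⟦⟧⁺ v∈w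

∈⟦⟧⁻ : ∀ (w : Subcube n) v → v ∈ˢ ⟦ w ⟧ → v ∈ᶜ w
∈⟦⟧⁻ [] [] _ = []
∈⟦⟧⁻ (bit false ∷ w) (false ∷ v) v∈w = bit ∷ ∈⟦⟧⁻ w v v∈w
∈⟦⟧⁻ (bit false ∷ w) (true ∷ v) v∈∅ = ⊥-elim (∉∅ v v∈∅)
∈⟦⟧⁻ (bit true ∷ w) (false ∷ v) v∈∅ = ⊥-elim (∉∅ v v∈∅)
∈⟦⟧⁻ (bit true ∷ w) (true ∷ v) v∈w = bit ∷ ∈⟦⟧⁻ w v v∈w
∈⟦⟧⁻ (∗ ∷ w) (false ∷ v) v∈w = ∗ ∷ ∈⟦⟧⁻ w v v∈w
∈⟦⟧⁻ (∗ ∷ w) (true ∷ v) v∈w = ∗ ∷ ∈⟦⟧⁻ w v v∈w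

embed : ∀ (w : Subcube n) → Word (dim w) → Word n
embed [] [] = []
embed (bit b ∷ w) x = b ∷ embed w x
embed (∗ ∷ w) (b ∷ x) = b ∷ embed w x

embed-∈ : ∀ (w : Subcube n) x → embed w x ∈ᶜ w
embed-∈ [] [] = []
embed-∈ (bit b ∷ w) x = bit ∷ embed-∈ w x
embed-∈ (∗ ∷ w) (b ∷ x) = ∗ ∷ embed-∈ w x

embed-onto : ∀ {v : Word n} → v ∈ᶜ w → ∃ λ x → embed w x ≡ v
embed-onto [] = [] , refl
embed-onto (bit {b} ∷ v∈w) with embed-onto v∈w
... | x , refl = x , refl
embed-onto (∗ {b} ∷ v∈w) with embed-onto v∈w
... | x , refl = b ∷ x , refl

embed-injective : ∀ (w : Subcube n) → Injective _≡_ _≡_ (embed w)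
embed-injective [] {[]} {[]} _ = refl
embed-injective (bit b ∷ w) eq = embed-injective w (∷-injectiveʳ eq)
embed-injective (∗ ∷ w) {_ ∷ _} {_ ∷ _} eq =
  cong₂ _∷_ (∷-injectiveˡ eq) (embed-injective w (∷-injectiveʳ eq))

hamming-embed : ∀ (w : Subcube n) x y → hamming (embed w x) (embed w y) ≡ hamming x y
hamming-embed [] [] [] = refl
hamming-embed (bit false ∷ w) x y = hamming-embed w x y
hamming-embed (bit true ∷ w) x y = hamming-embed w x y
hamming-embed (∗ ∷ w) (false ∷ x) (false ∷ y) = hamming-embed w x y
hamming-embed (∗ ∷ w) (false ∷ x) (true ∷ y) = cong suc (hamming-embed w x y)
hamming-embed (∗ ∷ w) (true ∷ x) (false ∷ y) = cong suc (hamming-embed w x y)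
hamming-embed (∗ ∷ w) (true ∷ x) (true ∷ y) = hamming-embed w x y

nonempty : ∀ (w : Subcube n) → ∃ (_∈ᶜ w)
nonempty w = embed w (replicate _ false) , embed-∈ w _

data _≼_ : Symbol → Symbol → Set where
  bit : bit b ≼ bit b
  ∗ : a ≼ ∗

_⊑_ : Subcube n → Subcube n → Set
_⊑_ = Pointwise _≼_

≼-refl : a ≼ a
≼-refl {bit _} = bit
≼-refl {∗} = ∗

≼-antisym : a ≼ a' → a' ≼ a → a ≡ a'
≼-antisym bit _ = refl
≼-antisym ∗ ∗ = refl

⊑-refl : w ⊑ w
⊑-refl = Pointwise.refl ≼-refl

⊑-antisym : w ⊑ w' → w' ⊑ w → w ≡ w'
⊑-antisym [] [] = refl
⊑-antisym (r ∷ rs) (r' ∷ rs') = cong₂ _∷_ (≼-antisym r r') (⊑-antisym rs rs')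

⊑⇒⊆ : w ⊑ w' → w ⊆ᶜ w'
⊑⇒⊆ w⊑w' v∈w = Pointwise.trans matches-≼ v∈w w⊑w'
  where
  matches-≼ : Matches b a → a ≼ a' → Matches b a'
  matches-≼ bit bit = bit
  matches-≼ _ ∗ = ∗

⊆⇒⊑ : ∀ (w w' : Subcube n) → w ⊆ᶜ w' → w ⊑ w'
⊆⇒⊑ [] [] _ = []
⊆⇒⊑ (bit b ∷ w) (a' ∷ w') w⊆w' =
  fixed-≼ (Pointwise.head (w⊆w' (bit ∷ proj₂ (nonempty w))))
    ∷ ⊆⇒⊑ w w' (λ v∈w → Pointwise.tail (w⊆w' (bit ∷ v∈w)))
  where
  fixed-≼ : Matches b a' → bit b ≼ a'
  fixed-≼ bit = bit
  fixed-≼ ∗ = ∗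
⊆⇒⊑ (∗ ∷ w) (a' ∷ w') w⊆w' =
  free-≼ (Pointwise.head (w⊆w' (∗ {false} ∷ proj₂ (nonempty w))))
         (Pointwise.head (w⊆w' (∗ {true} ∷ proj₂ (nonempty w))))
    ∷ ⊆⇒⊑ w w' (λ v∈w → Pointwise.tail (w⊆w' (∗ {false} ∷ v∈w)))
  where
  free-≼ : Matches false a' → Matches true a' → ∗ ≼ a'
  free-≼ ∗ _ = ∗

⟦⟧-injective : ⟦ w ⟧ ≡ ⟦ w' ⟧ → w ≡ w'
⟦⟧-injective {w = w} {w'} eq = ⊑-antisym (⊆⇒⊑ w w' (transport eq)) (⊆⇒⊑ w' w (transport (sym eq)))
  where
  transport : ∀ {w w' : Subcube n} → ⟦ w ⟧ ≡ ⟦ w' ⟧ → w ⊆ᶜ w'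
  transport {w' = w'} eq v∈w = ∈⟦⟧⁻ w' _ (subst (_ ∈ˢ_) eq (∈⟦⟧⁺ v∈w))

data Admissible : Bool → Subcube n → Set where
  [] : Admissible l []
  0∷_ : Admissible false w → Admissible l (bit false ∷ w)
  1∷_ : Admissible true w → Admissible false (bit true ∷ w)
  ∗∷_ : Admissible true w → Admissible false (∗ ∷ w)

admissible-sound : Admissible l w → ∀ {v} → v ∈ᶜ w → Fib (l ∷ v)
admissible-sound [] [] = tt
admissible-sound {l = false} (0∷ adm) (bit ∷ v∈w) = admissible-sound adm v∈w
admissible-sound {l = true} (0∷ adm) (bit ∷ v∈w) = admissible-sound adm v∈w
admissible-sound (1∷ adm) (bit ∷ v∈w) = admissible-sound adm v∈w
admissible-sound (∗∷ adm) {false ∷ v} (∗ ∷ v∈w) = Fib-true∷⇒false∷ v (admissible-sound adm v∈w)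
admissible-sound (∗∷ adm) (∗ {true} ∷ v∈w) = admissible-sound adm v∈w

admissible-complete : ∀ l (w : Subcube n) → (∀ {v} → v ∈ᶜ w → Fib (l ∷ v)) → Admissible l w
admissible-complete l [] _ = []
admissible-complete false (bit false ∷ w) fib = 0∷ admissible-complete false w (fib ∘ (bit ∷_))
admissible-complete true (bit false ∷ w) fib = 0∷ admissible-complete false w (fib ∘ (bit ∷_))
admissible-complete false (bit true ∷ w) fib = 1∷ admissible-complete true w (fib ∘ (bit ∷_))
admissible-complete true (bit true ∷ w) fib = ⊥-elim (fib (bit ∷ proj₂ (nonempty w)))
admissible-complete false (∗ ∷ w) fib = ∗∷ admissible-complete true w (fib ∘ (∗ ∷_))
admissible-complete true (∗ ∷ w) fib = ⊥-elim (fib (∗ {true} ∷ proj₂ (nonempty w)))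

admissible⇒isHypercube : {w : Subcube n} → Admissible false w → IsHypercube n (dim w) ⟦ w ⟧
admissible⇒isHypercube {w = w} adm =
  embed w ,
  (λ x → Fib-false∷⁻ (embed w x) (admissible-sound adm (embed-∈ w x))) ,
  (λ x → ∈⟦⟧⁺ (embed-∈ w x)) ,
  (λ v v∈w → embed-onto (∈⟦⟧⁻ w v v∈w)) ,
  (λ x y → embed-injective w) ,
  (λ x y → mk⇔ (trans (hamming-embed w x y)) (trans (sym (hamming-embed w x y))))

Disjoint : Subcube n → Subcube n → Set
Disjoint w₀ w₁ = ∀ {v} → v ∈ᶜ w₀ → v ∈ᶜ w₁ → ⊥

HasNeighboursIn : Subcube n → Subcube n → Set
HasNeighboursIn w₀ w₁ = ∀ {u} → u ∈ᶜ w₀ → ∃ λ v → v ∈ᶜ w₁ × Adj u v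

IsUnion : Subcube n → Subcube n → Subcube n → Set
IsUnion w w₀ w₁ = (∀ {v} → v ∈ᶜ w → v ∈ᶜ w₀ ⊎ v ∈ᶜ w₁) × w₀ ⊆ᶜ w × w₁ ⊆ᶜ w

Join : Subcube n → Subcube n → Set
Join w₀ w₁ = Σ[ w ∈ Subcube _ ] dim w ≡ suc (dim w₀) × IsUnion w w₀ w₁

Disjoint-∷⁻ : Disjoint (a ∷ w₀) (a ∷ w₁) → Disjoint w₀ w₁
Disjoint-∷⁻ {a = bit b} disj v∈w₀ v∈w₁ = disj (bit ∷ v∈w₀) (bit ∷ v∈w₁)
Disjoint-∷⁻ {a = ∗} disj v∈w₀ v∈w₁ = disj (∗ {false} ∷ v∈w₀) (∗ ∷ v∈w₁)

HasNeighboursIn-bit∷⁻ : HasNeighboursIn (bit b ∷ w₀) (bit b ∷ w₁) → HasNeighboursIn w₀ w₁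
HasNeighboursIn-bit∷⁻ {b = b} nbs {u} u∈w₀ with nbs (bit ∷ u∈w₀)
... | _ ∷ v , bit ∷ v∈w₁ , adj = v , v∈w₁ , Adj-∷⁻ b u v adj

HasNeighboursIn-∗∷⁻ : Disjoint (∗ ∷ w₀) (∗ ∷ w₁) →
  HasNeighboursIn (∗ ∷ w₀) (∗ ∷ w₁) → HasNeighboursIn w₀ w₁
HasNeighboursIn-∗∷⁻ disj nbs {u} u∈w₀ with nbs (∗ {false} ∷ u∈w₀)
... | false ∷ v , ∗ ∷ v∈w₁ , adj = v , v∈w₁ , adj
... | true ∷ v , ∗ ∷ v∈w₁ , adj with Adj-∷-≢ false true u v (λ ()) adj
...   | refl = ⊥-elim (disj (∗ {false} ∷ u∈w₀) (∗ ∷ v∈w₁))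

IsUnion-∷ : ∀ {w : Subcube n} → IsUnion w w₀ w₁ → IsUnion (a ∷ w) (a ∷ w₀) (a ∷ w₁)
IsUnion-∷ (split , w₀⊆w , w₁⊆w) =
  (λ { (m ∷ v∈w) → Sum.map (m ∷_) (m ∷_) (split v∈w) }) ,
  (λ { (m ∷ v∈w₀) → m ∷ w₀⊆w v∈w₀ }) ,
  (λ { (m ∷ v∈w₁) → m ∷ w₁⊆w v∈w₁ })

Join-∷ : ∀ a → Join w₀ w₁ → Join (a ∷ w₀) (a ∷ w₁)
Join-∷ (bit b) (w , dim-w , union) = bit b ∷ w , dim-w , IsUnion-∷ union
Join-∷ ∗ (w , dim-w , union) = ∗ ∷ w , cong suc dim-w , IsUnion-∷ union

-- Neighbours across opposite fixed first bits agree in the remaining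
-- coordinates, so the two tails have the same vertices.
IsUnion-opposite : ∀ b → HasNeighboursIn (bit b ∷ w₀) (bit (not b) ∷ w₁) →
  HasNeighboursIn (bit (not b) ∷ w₁) (bit b ∷ w₀) →
  IsUnion (∗ ∷ w₀) (bit b ∷ w₀) (bit (not b) ∷ w₁)
IsUnion-opposite {w₀ = w₀} {w₁ = w₁} b nbs₀ nbs₁ = split , w₀-part , w₁-part
  where
  w₀⊆w₁ : w₀ ⊆ᶜ w₁
  w₀⊆w₁ {u} u∈w₀ with nbs₀ (bit ∷ u∈w₀)
  ... | _ ∷ v , bit ∷ v∈w₁ , adj = subst (_∈ᶜ w₁) (sym (Adj-∷-≢ b (not b) u v (not-¬ {b} refl) adj)) v∈w₁
  w₁⊆w₀ : w₁ ⊆ᶜ w₀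
  w₁⊆w₀ {u} u∈w₁ with nbs₁ (bit ∷ u∈w₁)
  ... | _ ∷ v , bit ∷ v∈w₀ , adj = subst (_∈ᶜ w₀) (sym (Adj-∷-≢ (not b) b u v (not-¬ {b} refl ∘ sym) adj)) v∈w₀
  split : ∀ {v} → v ∈ᶜ (∗ ∷ w₀) → v ∈ᶜ (bit b ∷ w₀) ⊎ v ∈ᶜ (bit (not b) ∷ w₁)
  split {c ∷ v} (∗ ∷ v∈w₀) with c ≟ b
  ... | yes refl = inj₁ (bit ∷ v∈w₀)
  ... | no c≢b = inj₂ (subst (λ c → (c ∷ v) ∈ᶜ (bit (not b) ∷ w₁)) (sym (¬-not c≢b)) (bit ∷ w₀⊆w₁ v∈w₀))
  w₀-part : (bit b ∷ w₀) ⊆ᶜ (∗ ∷ w₀)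
  w₀-part (bit ∷ v∈w₀) = ∗ ∷ v∈w₀
  w₁-part : (bit (not b) ∷ w₁) ⊆ᶜ (∗ ∷ w₀)
  w₁-part (bit ∷ v∈w₁) = ∗ ∷ w₁⊆w₀ v∈w₁

-- The neighbour in bit b ∷ w₀ of (not b) x ∈ ∗ ∷ w₁ is b x, which lies in both.
bit-∗-separated : Disjoint (bit b ∷ w₀) (∗ ∷ w₁) → ¬ HasNeighboursIn (∗ ∷ w₁) (bit b ∷ w₀)
bit-∗-separated {b = b} {w₁ = w₁} disj nbs with nonempty w₁
... | x , x∈w₁ with nbs (∗ {not b} ∷ x∈w₁)
...   | _ ∷ y , bit ∷ y∈w₀ , adj =
  disj (bit ∷ y∈w₀) (∗ ∷ subst (_∈ᶜ w₁) (Adj-∷-≢ (not b) b x y (not-¬ {b} refl ∘ sym) adj) x∈w₁)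

join : ∀ (w₀ w₁ : Subcube n) → Disjoint w₀ w₁ →
  HasNeighboursIn w₀ w₁ → HasNeighboursIn w₁ w₀ → Join w₀ w₁
join [] [] disj _ _ = ⊥-elim (disj [] [])
join (bit false ∷ w₀) (bit false ∷ w₁) disj nbs₀ nbs₁ =
  Join-∷ (bit false) (join w₀ w₁ (Disjoint-∷⁻ disj)
    (HasNeighboursIn-bit∷⁻ nbs₀) (HasNeighboursIn-bit∷⁻ nbs₁))
join (bit true ∷ w₀) (bit true ∷ w₁) disj nbs₀ nbs₁ =
  Join-∷ (bit true) (join w₀ w₁ (Disjoint-∷⁻ disj)
    (HasNeighboursIn-bit∷⁻ nbs₀) (HasNeighboursIn-bit∷⁻ nbs₁))
join (bit false ∷ w₀) (bit true ∷ w₁) _ nbs₀ nbs₁ = ∗ ∷ w₀ , refl , IsUnion-opposite false nbs₀ nbs₁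
join (bit true ∷ w₀) (bit false ∷ w₁) _ nbs₀ nbs₁ = ∗ ∷ w₀ , refl , IsUnion-opposite true nbs₀ nbs₁
join (bit _ ∷ w₀) (∗ ∷ w₁) disj _ nbs₁ = ⊥-elim (bit-∗-separated disj nbs₁)
join (∗ ∷ w₀) (bit _ ∷ w₁) disj nbs₀ _ = ⊥-elim (bit-∗-separated (λ v∈w₁ v∈w₀ → disj v∈w₀ v∈w₁) nbs₀)
join (∗ ∷ w₀) (∗ ∷ w₁) disj nbs₀ nbs₁ =
  Join-∷ ∗ (join w₀ w₁ (Disjoint-∷⁻ disj)
    (HasNeighboursIn-∗∷⁻ disj nbs₀) (HasNeighboursIn-∗∷⁻ (λ v∈w₁ v∈w₀ → disj v∈w₀ v∈w₁) nbs₁))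

point : Word n → Subcube n
point = Vec.map bit

dim-point : ∀ (u : Word n) → dim (point u) ≡ 0
dim-point [] = refl
dim-point (_ ∷ u) = dim-point u

∈-point : ∀ (u : Word n) → u ∈ᶜ point u
∈-point [] = []
∈-point (_ ∷ u) = bit ∷ ∈-point u

∈-point⁻ : ∀ (u : Word n) {v} → v ∈ᶜ point u → v ≡ u
∈-point⁻ [] [] = refl
∈-point⁻ (b ∷ u) (bit ∷ v∈u) = cong (b ∷_) (∈-point⁻ u v∈u)

ImageIs : (Word p → Word n) → Subcube n → Set
ImageIs φ w = (∀ x → φ x ∈ᶜ w) × (∀ {v} → v ∈ᶜ w → ∃ λ x → φ x ≡ v)

PreservesAdj : (Word p → Word n) → Set
PreservesAdj φ = ∀ {x y} → Adj x y → Adj (φ x) (φ y)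

halves-disjoint : ∀ (φ : Word (suc p) → Word n) → Injective _≡_ _≡_ φ →
  ImageIs (φ ∘ (false ∷_)) w₀ → ImageIs (φ ∘ (true ∷_)) w₁ → Disjoint w₀ w₁
halves-disjoint φ inj (_ , onto₀) (_ , onto₁) v∈w₀ v∈w₁ with onto₀ v∈w₀ | onto₁ v∈w₁
... | x , refl | y , eq with ∷-injectiveˡ (inj eq)
...   | ()

halves-neighbours : ∀ b (φ : Word (suc p) → Word n) → PreservesAdj φ →
  ImageIs (φ ∘ (b ∷_)) w₀ → ImageIs (φ ∘ (not b ∷_)) w₁ → HasNeighboursIn w₀ w₁
halves-neighbours b φ adj (_ , onto₀) (into₁ , _) u∈w₀ with onto₀ u∈w₀
... | x , refl = φ (not b ∷ x) , into₁ x , adj (Adj-flip b x)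

image-union : ∀ (φ : Word (suc p) → Word n) {w : Subcube n} → IsUnion w w₀ w₁ →
  ImageIs (φ ∘ (false ∷_)) w₀ → ImageIs (φ ∘ (true ∷_)) w₁ → ImageIs φ w
image-union φ (split , w₀⊆w , w₁⊆w) (into₀ , onto₀) (into₁ , onto₁) = into , onto
  where
  into : ∀ x → φ x ∈ᶜ _
  into (false ∷ x) = w₀⊆w (into₀ x)
  into (true ∷ x) = w₁⊆w (into₁ x)
  onto : ∀ {v} → v ∈ᶜ _ → ∃ λ x → φ x ≡ v
  onto v∈w with split v∈w
  ... | inj₁ v∈w₀ = let x , eq = onto₀ v∈w₀ in false ∷ x , eq
  ... | inj₂ v∈w₁ = let x , eq = onto₁ v∈w₁ in true ∷ x , eq

image-isSubcube : ∀ p (φ : Word p → Word n) → Injective _≡_ _≡_ φ → PreservesAdj φ →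
  Σ[ w ∈ Subcube n ] dim w ≡ p × ImageIs φ w
image-isSubcube zero φ _ _ =
  point (φ []) , dim-point (φ []) , (λ { [] → ∈-point (φ []) }) , λ v∈w → [] , sym (∈-point⁻ (φ []) v∈w)
image-isSubcube (suc p) φ inj adj =
  let (w₀ , dim-w₀ , img₀) = image-isSubcube p (φ ∘ (false ∷_))
                               (λ eq → ∷-injectiveʳ (inj eq)) (λ {x} {y} → adj {false ∷ x} {false ∷ y})
      (w₁ , _ , img₁) = image-isSubcube p (φ ∘ (true ∷_))
                          (λ eq → ∷-injectiveʳ (inj eq)) (λ {x} {y} → adj {true ∷ x} {true ∷ y})
      (w , dim-w , union) = join w₀ w₁ (halves-disjoint φ inj img₀ img₁)
                              (halves-neighbours false φ adj img₀ img₁) (halves-neighbours true φ adj img₁ img₀)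
  in w , trans dim-w (cong suc dim-w₀) , image-union φ union img₀ img₁

isHypercube⇒admissible : ∀ {S : Sub n} → IsHypercube n p S →
  Σ[ w ∈ Subcube n ] Admissible false w × dim w ≡ p × S ≡ ⟦ w ⟧
isHypercube⇒admissible {p = p} {S} (φ , fib , φ∈S , onto , inj , adj)
  with image-isSubcube p φ (λ {x} {y} → inj x y) (λ {x} {y} → Equivalence.to (adj x y))
... | w , dim-w , φ∈w , w⊆φ = w , admissible-complete false w fib-w , dim-w , Sub-ext S ⟦ w ⟧ S⇔w
  where
  fib-w : ∀ {v} → v ∈ᶜ w → Fib (false ∷ v)
  fib-w v∈w with w⊆φ v∈w
  ... | x , refl = Fib-false∷⁺ (φ x) (fib x)
  S⇔w : ∀ v → v ∈ˢ S ⇔ v ∈ˢ ⟦ w ⟧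
  S⇔w v = mk⇔
    (λ v∈S → let x , eq = onto v v∈S in ∈⟦⟧⁺ (subst (_∈ᶜ w) eq (φ∈w x)))
    (λ v∈w → let x , eq = w⊆φ (∈⟦⟧⁻ w v v∈w) in subst (_∈ˢ S) eq (φ∈S x))

-- The flag records whether the symbol preceding w is ∗.
data Maximal : Bool → Subcube n → Set where
  [] : Maximal l []
  ∗∷_ : Maximal true w → Maximal false (∗ ∷ w)
  0∷_ : Maximal false w → Maximal true (bit false ∷ w)
  0∗∷_ : Maximal true w → Maximal false (bit false ∷ ∗ ∷ w)

maximal⇒admissible : Maximal l w → Admissible l w
maximal⇒admissible [] = []
maximal⇒admissible (∗∷ max) = ∗∷ maximal⇒admissible max
maximal⇒admissible (0∷ max) = 0∷ maximal⇒admissible max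
maximal⇒admissible (0∗∷ max) = 0∷ ∗∷ maximal⇒admissible max

maximal-unrefinable : Maximal l w → w ⊑ w' → Admissible l w' → w ≡ w'
maximal-unrefinable [] [] _ = refl
maximal-unrefinable (∗∷ max) (∗ ∷ r) (∗∷ adm) = cong (∗ ∷_) (maximal-unrefinable max r adm)
maximal-unrefinable (0∷ max) (bit ∷ r) (0∷ adm) = cong (bit false ∷_) (maximal-unrefinable max r adm)
maximal-unrefinable (0∗∷ max) (bit ∷ ∗ ∷ r) (0∷ ∗∷ adm) =
  cong (λ w → bit false ∷ ∗ ∷ w) (maximal-unrefinable max r adm)
maximal-unrefinable (0∗∷ max) (∗ ∷ ∗ ∷ r) (∗∷ ())

Extension : Bool → Subcube n → Set
Extension l w = Σ[ w' ∈ Subcube _ ] w ⊑ w' × dim w' ≡ suc (dim w) × Admissible l w'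

maximal⊎extension : Admissible l w → Maximal l w ⊎ Extension l w
maximal⊎extension [] = inj₁ []
maximal⊎extension (1∷ adm) = inj₂ (∗ ∷ _ , ∗ ∷ ⊑-refl , refl , ∗∷ adm)
maximal⊎extension (∗∷ adm) with maximal⊎extension adm
... | inj₁ max = inj₁ (∗∷ max)
... | inj₂ (w' , r , dim-w' , adm') = inj₂ (∗ ∷ w' , ∗ ∷ r , cong suc dim-w' , ∗∷ adm')
maximal⊎extension (0∷ adm) with maximal⊎extension adm
... | inj₂ (w' , r , dim-w' , adm') = inj₂ (bit false ∷ w' , bit ∷ r , dim-w' , 0∷ adm')
maximal⊎extension {l = true} (0∷ adm) | inj₁ max = inj₁ (0∷ max)
maximal⊎extension {l = false} (0∷ adm) | inj₁ [] = inj₂ (∗ ∷ [] , ∗ ∷ [] , refl , ∗∷ [])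
maximal⊎extension {l = false} (0∷ adm) | inj₁ (∗∷ max) = inj₁ (0∗∷ max)
maximal⊎extension {l = false} (0∷ 0∷ adm) | inj₁ (0∗∷ max) =
  inj₂ (∗ ∷ _ , ∗ ∷ ⊑-refl , refl , ∗∷ 0∷ adm)

maximal⇒isMaximalHypercube : ∀ {w : Subcube n} → Maximal false w → IsMaximalHypercube n (dim w) ⟦ w ⟧
maximal⇒isMaximalHypercube {w = w} max = admissible⇒isHypercube (maximal⇒admissible max) , uncontained
  where
  uncontained : ¬ (Σ[ T ∈ Sub _ ] IsHypercube _ (suc (dim w)) T × ⟦ w ⟧ ⊆ˢ T)
  uncontained (T , T-cube , w⊆T) with isHypercube⇒admissible T-cube
  ... | w' , adm' , dim-w' , refl = 1+n≢n (trans (sym dim-w') (cong dim (sym w≡w')))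
    where
    w≡w' : w ≡ w'
    w≡w' = maximal-unrefinable max (⊆⇒⊑ w w' (λ v∈w → ∈⟦⟧⁻ w' _ (w⊆T _ (∈⟦⟧⁺ v∈w)))) adm'

isMaximalHypercube⇒maximal : ∀ {S : Sub n} → IsMaximalHypercube n p S →
  Σ[ w ∈ Subcube n ] Maximal false w × dim w ≡ p × S ≡ ⟦ w ⟧
isMaximalHypercube⇒maximal (cube , uncontained) with isHypercube⇒admissible cube
... | w , adm , dim-w , refl with maximal⊎extension adm
...   | inj₁ max = w , max , dim-w , refl
...   | inj₂ (w' , w⊑w' , dim-w' , adm') = ⊥-elim (uncontained (⟦ w' ⟧ , w'-cube , w⊆w'))
  where
  w'-cube : IsHypercube _ (suc _) ⟦ w' ⟧
  w'-cube = subst (λ k → IsHypercube _ k ⟦ w' ⟧) (trans dim-w' (cong suc dim-w)) (admissible⇒isHypercube adm')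
  w⊆w' : ⟦ w ⟧ ⊆ˢ ⟦ w' ⟧
  w⊆w' v v∈w = ∈⟦⟧⁺ (⊑⇒⊆ w⊑w' (∈⟦⟧⁻ w v v∈w))

maximals : Bool → (n p : ℕ) → List (Subcube n)
maximals _ zero zero = [ [] ]ᴸ
maximals _ zero (suc p) = []ᴸ
maximals true (suc n) p = map (bit false ∷_) (maximals false n p)
maximals false (suc n) zero = []ᴸ
maximals false (suc zero) (suc p) = map (∗ ∷_) (maximals true zero p)
maximals false (suc (suc n)) (suc p) =
  map (λ w → bit false ∷ ∗ ∷ w) (maximals true n p) ++ map (∗ ∷_) (maximals true (suc n) p)

∈-maximals⁻ : ∀ l n p {w : Subcube n} → w ∈ maximals l n p → Maximal l w × dim w ≡ p
∈-maximals⁻ _ zero zero (here refl) = [] , refl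
∈-maximals⁻ true (suc n) p w∈ with ∈-map⁻ (bit false ∷_) w∈
... | _ , w∈' , refl = Product.map 0∷_ id (∈-maximals⁻ false n p w∈')
∈-maximals⁻ false (suc zero) (suc p) w∈ with ∈-map⁻ (∗ ∷_) w∈
... | _ , w∈' , refl = Product.map ∗∷_ (cong suc) (∈-maximals⁻ true zero p w∈')
∈-maximals⁻ false (suc (suc n)) (suc p) w∈
  with ∈-++⁻ (map (λ w → bit false ∷ ∗ ∷ w) (maximals true n p)) w∈
... | inj₁ w∈' with ∈-map⁻ (λ w → bit false ∷ ∗ ∷ w) w∈'
...   | _ , w∈'' , refl = Product.map 0∗∷_ (cong suc) (∈-maximals⁻ true n p w∈'')
∈-maximals⁻ false (suc (suc n)) (suc p) w∈ | inj₂ w∈' with ∈-map⁻ (∗ ∷_) w∈'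
...   | _ , w∈'' , refl = Product.map ∗∷_ (cong suc) (∈-maximals⁻ true (suc n) p w∈'')

∈-maximals⁺ : ∀ {w : Subcube n} → Maximal l w → w ∈ maximals l n (dim w)
∈-maximals⁺ [] = here refl
∈-maximals⁺ (0∷ max) = ∈-map⁺ (bit false ∷_) (∈-maximals⁺ max)
∈-maximals⁺ (∗∷ []) = here refl
∈-maximals⁺ (∗∷ max@(0∷ _)) = ∈-++⁺ʳ _ (∈-map⁺ (∗ ∷_) (∈-maximals⁺ max))
∈-maximals⁺ (0∗∷ max) = ∈-++⁺ˡ (∈-map⁺ (λ w → bit false ∷ ∗ ∷ w) (∈-maximals⁺ max))

maximals-unique : ∀ l n p → Unique (maximals l n p)
maximals-unique _ zero zero = All.[] AllPairs.∷ AllPairs.[]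
maximals-unique _ zero (suc p) = AllPairs.[]
maximals-unique true (suc n) p = Unique.map⁺ ∷-injectiveʳ (maximals-unique false n p)
maximals-unique false (suc n) zero = AllPairs.[]
maximals-unique false (suc zero) (suc p) = Unique.map⁺ ∷-injectiveʳ (maximals-unique true zero p)
maximals-unique false (suc (suc n)) (suc p) =
  Unique.++⁺ (Unique.map⁺ (∷-injectiveʳ ∘ ∷-injectiveʳ) (maximals-unique true n p))
             (Unique.map⁺ ∷-injectiveʳ (maximals-unique true (suc n) p))
             heads-differ
  where
  heads-differ : ∀ {w} → ¬ (w ∈ map (λ w → bit false ∷ ∗ ∷ w) (maximals true n p) × w ∈ map (∗ ∷_) _)
  heads-differ (w∈₀ , w∈₁) with ∈-map⁻ _ w∈₀ | ∈-map⁻ _ w∈₁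
  ... | _ , _ , refl | _ , _ , ()

shiftedC : ℕ → ℕ → ℕ → ℕ
shiftedC t zero m = t C m
shiftedC t (suc k) zero = 0
shiftedC t (suc k) (suc m) = shiftedC t k m

shiftedC-if : ∀ t k m → shiftedC t k m ≡ (if m <ᵇ k then 0 else t C (m ∸ k))
shiftedC-if t zero zero = refl
shiftedC-if t zero (suc m) = refl
shiftedC-if t (suc k) zero = refl
shiftedC-if t (suc k) (suc m) = shiftedC-if t k m

shiftedC-suc-0 : ∀ t k → shiftedC (suc t) k 0 ≡ shiftedC t k 0
shiftedC-suc-0 t zero = refl
shiftedC-suc-0 t (suc k) = refl

shiftedC-pascal : ∀ t k m → shiftedC (suc t) k (suc m) ≡ shiftedC t k m + shiftedC t k (suc m)
shiftedC-pascal t zero m = sym (nCk+nC[k+1]≡[n+1]C[k+1] t m)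
shiftedC-pascal t (suc k) zero = shiftedC-suc-0 t k
shiftedC-pascal t (suc k) (suc m) = shiftedC-pascal t k m

shiftedC-double-suc : ∀ t p m → shiftedC t (2 * suc p) m ≡ shiftedC t (suc (suc (2 * p))) m
shiftedC-double-suc t p m = cong (λ k → shiftedC t k m) (*-suc 2 p)

length-maximals-true : ∀ n p → length (maximals true n p) ≡ shiftedC (suc p) (2 * p) n
length-maximals-false : ∀ n p → length (maximals false n p) ≡ shiftedC (suc p) (2 * p) (suc n)

length-maximals-true zero zero = refl
length-maximals-true zero (suc p) = sym (shiftedC-double-suc (suc (suc p)) p 0)
length-maximals-true (suc n) p =
  trans (length-map (bit false ∷_) (maximals false n p)) (length-maximals-false n p)

length-maximals-false zero zero = refl
length-maximals-false zero (suc p) = sym (shiftedC-double-suc (suc (suc p)) p 1)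
length-maximals-false (suc n) zero = refl
length-maximals-false (suc zero) (suc p) = begin
  length (map (∗ ∷_) (maximals true zero p))  ≡⟨ length-map (∗ ∷_) (maximals true zero p) ⟩
  length (maximals true zero p)               ≡⟨ length-maximals-true zero p ⟩
  shiftedC (suc p) (2 * p) 0                  ≡⟨ shiftedC-suc-0 (suc p) (2 * p) ⟨
  shiftedC (suc (suc p)) (2 * p) 0            ≡⟨ shiftedC-double-suc (suc (suc p)) p 2 ⟨
  shiftedC (suc (suc p)) (2 * suc p) 2        ∎
  where open ≡-Reasoning
length-maximals-false (suc (suc n)) (suc p) = begin
  length (map (λ w → bit false ∷ ∗ ∷ w) (maximals true n p) ++ map (∗ ∷_) (maximals true (suc n) p))
    ≡⟨ length-++ (map (λ w → bit false ∷ ∗ ∷ w) (maximals true n p)) ⟩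
  length (map (λ w → bit false ∷ ∗ ∷ w) (maximals true n p)) + length (map (∗ ∷_) (maximals true (suc n) p))
    ≡⟨ cong₂ _+_ (length-map _ (maximals true n p)) (length-map _ (maximals true (suc n) p)) ⟩
  length (maximals true n p) + length (maximals true (suc n) p)
    ≡⟨ cong₂ _+_ (length-maximals-true n p) (length-maximals-true (suc n) p) ⟩
  shiftedC (suc p) (2 * p) n + shiftedC (suc p) (2 * p) (suc n)
    ≡⟨ shiftedC-pascal (suc p) (2 * p) n ⟨
  shiftedC (suc (suc p)) (2 * p) (suc n)
    ≡⟨ shiftedC-double-suc (suc (suc p)) p (suc (suc (suc n))) ⟨
  shiftedC (suc (suc p)) (2 * suc p) (suc (suc (suc n)))
    ∎
  where open ≡-Reasoning

length-maximals : ∀ n p → length (maximals false n p) ≡ fibMaxCount n p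
length-maximals n p = begin
  length (maximals false n p)                                 ≡⟨ length-maximals-false n p ⟩
  shiftedC (suc p) (2 * p) (suc n)                            ≡⟨ cong (shiftedC (suc p) (2 * p)) (+-comm 1 n) ⟩
  shiftedC (suc p) (2 * p) (n + 1)                            ≡⟨ shiftedC-if (suc p) (2 * p) (n + 1) ⟩
  fibMaxCount n p                                             ∎
  where open ≡-Reasoning

∈-maximalHypercubes : ∀ {S : Sub n} → S ∈ map ⟦_⟧ (maximals false n p) ⇔ IsMaximalHypercube n p S
∈-maximalHypercubes {n} {p} = mk⇔ to from
  where
  to : ∀ {S} → S ∈ map ⟦_⟧ (maximals false n p) → IsMaximalHypercube n p S
  to S∈ with ∈-map⁻ ⟦_⟧ S∈
  ... | w , w∈ , refl with ∈-maximals⁻ false n p w∈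
  ...   | max , refl = maximal⇒isMaximalHypercube max
  from : ∀ {S} → IsMaximalHypercube n p S → S ∈ map ⟦_⟧ (maximals false n p)
  from S-max with isMaximalHypercube⇒maximal S-max
  ... | w , max , refl , refl = ∈-map⁺ ⟦_⟧ (∈-maximals⁺ max)

theorem1 : (n p : ℕ) → p ≤ n →
    Σ (List (Sub n)) λ hs →
      Unique hs × (∀ S → (S ∈ hs) ⇔ IsMaximalHypercube n p S) × length hs ≡ fibMaxCount n p
theorem1 n p _ =
  map ⟦_⟧ (maximals false n p) ,
  Unique.map⁺ ⟦⟧-injective (maximals-unique false n p) ,
  (λ S → ∈-maximalHypercubes) ,
  trans (length-map ⟦_⟧ (maximals false n p)) (length-maximals n p)
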